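{- For every $x\in\mathcal{H}$ the set ${\downarrow}x$, and for every $s\in\mathbb{N}^*$ the set ${\downarrow}L_s$ where $L_s=\{(m,s)\mid m\in\mathbb{N}\}$, is a Scott-closed irreducible subset of $\mathcal{H}$.
   Context: Let $\mathbb{N}^*$ be the set of finite strings of natural numbers; $\varepsilon$ is the empty string, $n{:}s$ is $s$ with $n$ put in front, $ts$ is concatenation, and for nonempty $t$, $\min(t)$ is its least entry. On $\mathbb{N}\times\mathbb{N}^*$ define, for $m,m',n,n'\in\mathbb{N}$, $s,t\in\mathbb{N}^*$: $(m,n{:}s)<_1(m,n'{:}s)$ if $n<n'$; $(m,ts)<_2(m,s)$ if $t\neq\varepsilon$; $(m,ts)<_3(m',s)$ if $t\ne\varepsilon$ and $\min(t)\le m'$. Let $<\;=\;<_1\cup<_2\cup<_3\cup(<_2;<_1)\cup(<_3;<_1)$ ($x\,(R;R')\,z$ iff $\exists y$, $x\,R\,y$, $y\,R'\,z$) and $\le\;=\;<\cup=$; $\mathcal{H}=(\mathbb{N}\times\mathbb{N}^*,\le)$, a dcpo. Irreducible means (with respect to the Scott topology) nonempty and, whenever contained in a union of two Scott-closed sets, contained in one of them. -}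

module Defs where

open import Level using (0ℓ)
open import Data.Nat using (ℕ; _<_; _≤_; _⊓_)
open import Data.List using (List; []; _∷_; _++_; foldr)
open import Data.Product using (Σ; ∃; _×_; _,_)
open import Data.Sum using (_⊎_)
open import Relation.Binary.PropositionalEquality using (_≡_)
open import Relation.Unary using (Pred; _⊆_; _∪_)

-- The carrier ℕ × ℕ*
H : Set
H = ℕ × List ℕ

minNE : ℕ → List ℕ → ℕ
minNE k t = foldr _⊓_ k t

data _<₁_ : H → H → Set where
  lt₁ : ∀ {m n n' s} → n < n' → (m , n ∷ s) <₁ (m , n' ∷ s)

-- (m, ts) <₂ (m, s) if t ≠ ε   (t written k ∷ t')
data _<₂_ : H → H → Set where
  lt₂ : ∀ {m} k t s → (m , (k ∷ t) ++ s) <₂ (m , s)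

data _<₃_ : H → H → Set where
  lt₃ : ∀ {m m'} k t s → minNE k t ≤ m' → (m , (k ∷ t) ++ s) <₃ (m' , s)

_⨾_ : (H → H → Set) → (H → H → Set) → H → H → Set
(R ⨾ R') x z = ∃ λ y → R x y × R' y z

_<H_ : H → H → Set
x <H y = x <₁ y ⊎ x <₂ y ⊎ x <₃ y ⊎ (_<₂_ ⨾ _<₁_) x y ⊎ (_<₃_ ⨾ _<₁_) x y

_≤H_ : H → H → Set
x ≤H y = x <H y ⊎ x ≡ y

Subset : Set₁
Subset = Pred H 0ℓ

IsUpperBound : Subset → H → Set
IsUpperBound D x = ∀ {y} → D y → y ≤H x

IsSup : Subset → H → Set
IsSup D x = IsUpperBound D x × (∀ z → IsUpperBound D z → x ≤H z)

Directed : Subset → Set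
Directed D = (∃ λ x → D x)
           × (∀ {x y} → D x → D y → ∃ λ z → D z × x ≤H z × y ≤H z)

ScottClosed : Subset → Set₁
ScottClosed C = (∀ {x y} → x ≤H y → C y → C x)
              × (∀ (D : Subset) x → Directed D → D ⊆ C → IsSup D x → C x)

Irreducible : Subset → Set₁
Irreducible A = (∃ λ x → A x)
              × (∀ (C₁ C₂ : Subset) → ScottClosed C₁ → ScottClosed C₂
                   → A ⊆ (C₁ ∪ C₂) → (A ⊆ C₁) ⊎ (A ⊆ C₂))

↓_ : H → Subset
↓ x = λ y → y ≤H x

↓L : List ℕ → Subset
↓L s = λ y → ∃ λ m → y ≤H (m , s)

-- Every step of the order drops a nonempty prefix of the string (the first
-- coordinate may then change only to a value bounding some dropped entry) or
-- raises the head entry, and every x ≤ y factors as such a drop followed by a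
-- head raise.  Principal ideals ↓x are Scott-closed and irreducible in any dcpo.
-- For ↓L_s: each (m , t) ∈ ↓L_s lies below (m , s), and in a directed
-- D ⊆ ↓L_s an element y with shortest string has the same first coordinate as
-- everything above it, so (proj₁ y , s) bounds D.  For irreducibility, (j , s)
-- is the supremum of the chain (j , n ∷ s), and (j , n ∷ s) ≤ (m , s) once
-- n ≤ m; hence a Scott-closed set containing (m , s) for arbitrarily large m
-- contains all of ↓L_s, and of two closed sets covering L_s one does.
module Submission where

open import Defs
open import Level using (0ℓ)
open import Data.Nat using (ℕ)
open import Data.List using (List)
open import Data.Product using (_×_)
open import Axiom.ExcludedMiddle using (ExcludedMiddle)

open import Data.Nat using (suc; s≤s; _<_; _≤_; _≤?_; _⊔_)
open import Data.Nat.Properties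
open import Data.Nat.Induction using (<-wellFounded)
open import Data.List using ([]; _∷_; _++_; length)
open import Data.List.Properties using (++-assoc; length-++-≤ʳ; foldr-preservesᵒ; foldr-preservesᵇ)
open import Data.List.Relation.Unary.Any as Any using (Any; here; there; any?)
open import Data.List.Relation.Unary.Any.Properties using (++⁺ˡ; ++⁺ʳ)
open import Data.List.Relation.Unary.All as All using (All; _∷_)
open import Data.List.Relation.Unary.All.Properties using (¬Any⇒All¬)
open import Data.Product using (∃; _,_; proj₁)
open import Data.Sum using (_⊎_; inj₁; inj₂; [_,_]′)
import Data.Sum as Sum
open import Data.Empty using (⊥-elim)
open import Induction.WellFounded using (Acc; acc)
open import Relation.Binary.Construct.Closure.Reflexive using (ReflClosure; refl; [_])
import Relation.Binary.Construct.Closure.Reflexive.Properties as ReflClosure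
open import Relation.Binary.PropositionalEquality using (_≡_; refl; sym; subst)
open import Relation.Nullary using (yes; no; contradiction)
open import Relation.Unary using (Pred; _⊆_)

Any≤⇒minNE≤ : ∀ {m} k t → Any (_≤ m) (k ∷ t) → minNE k t ≤ m
Any≤⇒minNE≤ k t k∷t≤m =
  foldr-preservesᵒ (λ x y → [ m≤n⇒m⊓o≤n y , m≤n⇒o⊓m≤n x ]′) k t (Any.toSum k∷t≤m)

minNE≤⇒Any≤ : ∀ {m} k t → minNE k t ≤ m → Any (_≤ m) (k ∷ t)
minNE≤⇒Any≤ {m} k t min≤m with any? (_≤? m) (k ∷ t)
... | yes k∷t≤m = k∷t≤m
... | no ¬k∷t≤m with All.map ≰⇒> (¬Any⇒All¬ (k ∷ t) ¬k∷t≤m)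
...   | m<k ∷ m<t = contradiction min≤m (<⇒≱ (foldr-preservesᵇ ⊓-pres-m< m<k m<t))

Admissible : List ℕ → ℕ → ℕ → Set
Admissible t m m' = m ≡ m' ⊎ Any (_≤ m') t

Admissible-++ : ∀ {m m' m''} t t' →
  Admissible t m m' → Admissible t' m' m'' → Admissible (t ++ t') m m''
Admissible-++ t t' (inj₁ refl) (inj₁ refl)   = inj₁ refl
Admissible-++ t t' (inj₁ refl) (inj₂ t'≤m'') = inj₂ (++⁺ʳ t t'≤m'')
Admissible-++ t t' (inj₂ t≤m') (inj₁ refl)   = inj₂ (++⁺ˡ t≤m')
Admissible-++ t t' (inj₂ _)    (inj₂ t'≤m'') = inj₂ (++⁺ʳ t t'≤m'')

-- (m , (k ∷ t) ++ s) ◃ (m' , s) is exactly <₂ ∪ <₃.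
data _◃_ : H → H → Set where
  ◃-refl : ∀ {x} → x ◃ x
  drop   : ∀ {m m'} k t s → Admissible (k ∷ t) m m' → (m , (k ∷ t) ++ s) ◃ (m' , s)

◃-trans : ∀ {x y z} → x ◃ y → y ◃ z → x ◃ z
◃-trans ◃-refl y◃z = y◃z
◃-trans x◃y ◃-refl = x◃y
◃-trans {m , _} {z = z} (drop k t _ adm) (drop k' t' u adm') =
  subst (λ w → (m , w) ◃ z) (++-assoc (k ∷ t) (k' ∷ t') u)
    (drop k (t ++ k' ∷ t') u (Admissible-++ (k ∷ t) (k' ∷ t') adm adm'))

_≼₁_ : H → H → Set
_≼₁_ = ReflClosure _<₁_

<₁-trans : ∀ {x y z} → x <₁ y → y <₁ z → x <₁ z
<₁-trans (lt₁ n<n') (lt₁ n'<n'') = lt₁ (<-trans n<n' n'<n'')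

◃-≼₁-commute : ∀ {x y z} → y ◃ z → x ≼₁ y → (_◃_ ⨾ _≼₁_) x z
◃-≼₁-commute ◃-refl           x≼y         = _ , ◃-refl , x≼y
◃-≼₁-commute y◃z              refl        = _ , y◃z , refl
◃-≼₁-commute (drop k t s adm) [ lt₁ n<k ] = _ , drop _ t s (Sum.map₂ lowerHead adm) , refl
  where
  lowerHead : ∀ {m'} → Any (_≤ m') (k ∷ t) → Any (_≤ m') (_ ∷ t)
  lowerHead (here k≤m')  = here (≤-trans (<⇒≤ n<k) k≤m')
  lowerHead (there t≤m') = there t≤m'

_⊑_ : H → H → Set
_⊑_ = _◃_ ⨾ _≼₁_

⊑-refl : ∀ {x} → x ⊑ x
⊑-refl = _ , ◃-refl , refl

⊑-trans : ∀ {x y z} → x ⊑ y → y ⊑ z → x ⊑ z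
⊑-trans (_ , x◃y , y≼z) (_ , z◃w , w≼v) with ◃-≼₁-commute z◃w y≼z
... | _ , y◃y' , y'≼w = _ , ◃-trans x◃y y◃y' , ReflClosure.trans <₁-trans y'≼w w≼v

◃-cases : ∀ {x y} → x ◃ y → x ≡ y ⊎ x <₂ y ⊎ x <₃ y
◃-cases ◃-refl                     = inj₁ refl
◃-cases (drop k t s (inj₁ refl))   = inj₂ (inj₁ (lt₂ k t s))
◃-cases (drop k t s (inj₂ k∷t≤m')) = inj₂ (inj₂ (lt₃ k t s (Any≤⇒minNE≤ k t k∷t≤m')))

⊑⇒≤H : ∀ {x y} → x ⊑ y → x ≤H y
⊑⇒≤H (_ , x◃y , refl) with ◃-cases x◃y
... | inj₁ x≡y        = inj₂ x≡y
... | inj₂ (inj₁ x<y) = inj₁ (inj₂ (inj₁ x<y))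
... | inj₂ (inj₂ x<y) = inj₁ (inj₂ (inj₂ (inj₁ x<y)))
⊑⇒≤H (_ , x◃y , [ y<z ]) with ◃-cases x◃y
... | inj₁ refl       = inj₁ (inj₁ y<z)
... | inj₂ (inj₁ x<y) = inj₁ (inj₂ (inj₂ (inj₂ (inj₁ (_ , x<y , y<z)))))
... | inj₂ (inj₂ x<y) = inj₁ (inj₂ (inj₂ (inj₂ (inj₂ (_ , x<y , y<z)))))

<₂⇒◃ : ∀ {x y} → x <₂ y → x ◃ y
<₂⇒◃ (lt₂ k t s) = drop k t s (inj₁ refl)

<₃⇒◃ : ∀ {x y} → x <₃ y → x ◃ y
<₃⇒◃ (lt₃ k t s min≤m') = drop k t s (inj₂ (minNE≤⇒Any≤ k t min≤m'))

≤H⇒⊑ : ∀ {x y} → x ≤H y → x ⊑ y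
≤H⇒⊑ (inj₂ refl)                                        = ⊑-refl
≤H⇒⊑ (inj₁ (inj₁ x<y))                                  = _ , ◃-refl , [ x<y ]
≤H⇒⊑ (inj₁ (inj₂ (inj₁ x<y)))                           = _ , <₂⇒◃ x<y , refl
≤H⇒⊑ (inj₁ (inj₂ (inj₂ (inj₁ x<y))))                    = _ , <₃⇒◃ x<y , refl
≤H⇒⊑ (inj₁ (inj₂ (inj₂ (inj₂ (inj₁ (_ , x<y , y<z)))))) = _ , <₂⇒◃ x<y , [ y<z ]
≤H⇒⊑ (inj₁ (inj₂ (inj₂ (inj₂ (inj₂ (_ , x<y , y<z)))))) = _ , <₃⇒◃ x<y , [ y<z ]

≤H-trans : ∀ {x y z} → x ≤H y → y ≤H z → x ≤H z
≤H-trans x≤y y≤z = ⊑⇒≤H (⊑-trans (≤H⇒⊑ x≤y) (≤H⇒⊑ y≤z))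

≼₁-retarget : ∀ {m v m' s j} → (m , v) ≼₁ (m' , s) → (j , v) ≼₁ (j , s)
≼₁-retarget refl         = refl
≼₁-retarget [ lt₁ n<n' ] = [ lt₁ n<n' ]

⊑-retarget : ∀ {j w m s} → (j , w) ⊑ (m , s) → (j , w) ⊑ (j , s)
⊑-retarget (_ , ◃-refl , y≼z)       = _ , ◃-refl , ≼₁-retarget y≼z
⊑-retarget (_ , drop k t v _ , v≼s) = _ , drop k t v (inj₁ refl) , ≼₁-retarget v≼s

len : H → ℕ
len (_ , s) = length s

≼₁-len : ∀ {x y} → x ≼₁ y → len x ≡ len y
≼₁-len refl      = refl
≼₁-len [ lt₁ _ ] = refl

≼₁-fst : ∀ {x y} → x ≼₁ y → proj₁ x ≡ proj₁ y
≼₁-fst refl      = refl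
≼₁-fst [ lt₁ _ ] = refl

⊑-fst : ∀ {x y} → x ⊑ y → len x ≤ len y → proj₁ x ≡ proj₁ y
⊑-fst (_ , ◃-refl , x≼y)       _    = ≼₁-fst x≼y
⊑-fst (_ , drop k t s _ , s≼z) len≤ =
  contradiction len≤ (<⇒≱ (subst (_< suc (length (t ++ s))) (≼₁-len s≼z) (s≤s (length-++-≤ʳ s {t}))))

head⁰ : List ℕ → ℕ
head⁰ []      = 0
head⁰ (n ∷ _) = n

⊑-dropHead : ∀ {j N s i w} → i < N → head⁰ w < N → (j , N ∷ s) ⊑ (i , w) → (j , s) ⊑ (i , w)
⊑-dropHead i<N w<N (_ , ◃-refl , refl)                             = ⊥-elim (<-irrefl refl w<N)
⊑-dropHead i<N w<N (_ , ◃-refl , [ lt₁ N<n ])                      = ⊥-elim (<-asym N<n w<N)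
⊑-dropHead i<N w<N (_ , drop _ [] v (inj₁ refl) , v≼w)            = _ , ◃-refl , v≼w
⊑-dropHead i<N w<N (_ , drop _ (k ∷ t) v (inj₁ refl) , v≼w)       = _ , drop k t v (inj₁ refl) , v≼w
⊑-dropHead i<N w<N (_ , drop _ (k ∷ t) v (inj₂ (there t≤i)) , v≼w) = _ , drop k t v (inj₂ t≤i) , v≼w
⊑-dropHead i<N w<N (_ , drop _ _ v (inj₂ (here N≤i)) , v≼w) =
  contradiction (subst (_ ≤_) (≼₁-fst v≼w) N≤i) (<⇒≱ i<N)

≤H-fst : ∀ {x y} → x ≤H y → len x ≤ len y → proj₁ x ≡ proj₁ y
≤H-fst x≤y = ⊑-fst (≤H⇒⊑ x≤y)

cons-≤H : ∀ {j m n s} → j ≡ m ⊎ n ≤ m → (j , n ∷ s) ≤H (m , s)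
cons-≤H {n = n} {s} adm = ⊑⇒≤H (_ , drop n [] s (Sum.map₂ here adm) , refl)

raiseHead : ∀ {j s a b} → a ≤ b → (j , a ∷ s) ≤H (j , b ∷ s)
raiseHead a≤b with m≤n⇒m<n∨m≡n a≤b
... | inj₁ a<b  = inj₁ (inj₁ (lt₁ a<b))
... | inj₂ refl = inj₂ refl

↓L-below : ∀ {s x} → ↓L s x → x ≤H (proj₁ x , s)
↓L-below (_ , x≤ms) = ⊑⇒≤H (⊑-retarget (≤H⇒⊑ x≤ms))

∃-argmin : ExcludedMiddle 0ℓ → {A : Set} (f : A → ℕ) {P : Pred A 0ℓ} →
           ∃ P → ∃ λ a → P a × (∀ {b} → P b → f a ≤ f b)
∃-argmin em f {P} (a , Pa) = go a Pa (<-wellFounded (f a))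
  where
  go : ∀ a → P a → Acc _<_ (f a) → ∃ λ a → P a × (∀ {b} → P b → f a ≤ f b)
  go a Pa (acc smaller) with em {∃ λ b → P b × f b < f a}
  ... | yes (b , Pb , fb<fa) = go b Pb (smaller fb<fa)
  ... | no ¬smaller          = a , Pa , λ Pb → ≮⇒≥ (λ fb<fa → ¬smaller (_ , Pb , fb<fa))

Cofinal : Pred ℕ 0ℓ → Set
Cofinal P = ∀ n → ∃ λ m → n ≤ m × P m

cofinal-⊎ : ExcludedMiddle 0ℓ → {P Q : Pred ℕ 0ℓ} → (∀ m → P m ⊎ Q m) → Cofinal P ⊎ Cofinal Q
cofinal-⊎ em {P} {Q} P∪Q with em {Cofinal P}
... | yes cofinalP = inj₁ cofinalP
... | no ¬cofinalP = inj₂ cofinalQ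
  where
  cofinalQ : Cofinal Q
  cofinalQ n with em {∃ λ m → n ≤ m × Q m}
  ... | yes Q-above-n = Q-above-n
  ... | no ¬Q-above-n = contradiction (λ n' → n ⊔ n' , m≤n⊔m n n' , P-above-n (m≤m⊔n n n')) ¬cofinalP
    where
    P-above-n : ∀ {m} → n ≤ m → P m
    P-above-n {m} n≤m = Sum.fromInj₁ (λ Qm → contradiction (m , n≤m , Qm) ¬Q-above-n) (P∪Q m)

↓-isScottClosed : ∀ x → ScottClosed (↓ x)
↓-isScottClosed x = ≤H-trans , λ _ _ _ D⊆↓x (_ , least) → least x D⊆↓x

↓-isIrreducible : ∀ x → Irreducible (↓ x)
↓-isIrreducible x = (x , inj₂ refl) , λ _ _ (lower₁ , _) (lower₂ , _) cover →
  Sum.map (λ C₁x y≤x → lower₁ y≤x C₁x) (λ C₂x y≤x → lower₂ y≤x C₂x) (cover (inj₂ refl))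

↓L-isScottClosed : ExcludedMiddle 0ℓ → ∀ s → ScottClosed (↓L s)
↓L-isScottClosed em s = (λ x≤y (m , y≤ms) → m , ≤H-trans x≤y y≤ms) , supClosed
  where
  supClosed : ∀ D x → Directed D → D ⊆ ↓L s → IsSup D x → ↓L s x
  supClosed D x (inhabited , directed) D⊆↓L (_ , least) with ∃-argmin em len inhabited
  ... | y , Dy , shortest = proj₁ y , least (proj₁ y , s) bound
    where
    bound : IsUpperBound D (proj₁ y , s)
    bound Dd with directed Dd Dy
    ... | z , Dz , d≤z , y≤z =
      ≤H-trans d≤z (subst (λ j → z ≤H (j , s)) (sym (≤H-fst y≤z (shortest Dz))) (↓L-below (D⊆↓L Dz)))

Chain : ℕ → List ℕ → Subset
Chain j s x = ∃ λ n → x ≡ (j , n ∷ s)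

Chain-directed : ∀ j s → Directed (Chain j s)
Chain-directed j s = (_ , 0 , refl) , λ where
  (a , refl) (b , refl) → _ , (a ⊔ b , refl) , raiseHead (m≤m⊔n a b) , raiseHead (m≤n⊔m a b)

Chain-sup : ∀ j s → IsSup (Chain j s) (j , s)
Chain-sup j s = (λ { (_ , refl) → cons-≤H (inj₁ refl) }) , least
  where
  least : ∀ z → IsUpperBound (Chain j s) z → (j , s) ≤H z
  -- Past both i and the head of w, (j , N ∷ s) can lie below (i , w) only by dropping N.
  least (i , w) bound = ⊑⇒≤H (⊑-dropHead (s≤s (m≤m⊔n i (head⁰ w))) (s≤s (m≤n⊔m i (head⁰ w)))
                                          (≤H⇒⊑ (bound (suc (i ⊔ head⁰ w) , refl))))

cofinal⇒↓L⊆ : ∀ {C} s → ScottClosed C → Cofinal (λ m → C (m , s)) → ↓L s ⊆ C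
cofinal⇒↓L⊆ {C} s (lower , supClosed) cofinal x∈↓L = lower (↓L-below x∈↓L) (column _)
  where
  column : ∀ j → C (j , s)
  column j = supClosed (Chain j s) (j , s) (Chain-directed j s) Chain⊆C (Chain-sup j s)
    where
    Chain⊆C : Chain j s ⊆ C
    Chain⊆C (n , refl) with cofinal n
    ... | m , n≤m , Cms = lower (cons-≤H (inj₂ n≤m)) Cms

↓L-isIrreducible : ExcludedMiddle 0ℓ → ∀ s → Irreducible (↓L s)
↓L-isIrreducible em s = ((0 , s) , 0 , inj₂ refl) , λ _ _ closed₁ closed₂ cover →
  Sum.map (cofinal⇒↓L⊆ s closed₁) (cofinal⇒↓L⊆ s closed₂) (cofinal-⊎ em (λ m → cover (m , inj₂ refl)))

proposition5p6 : ExcludedMiddle 0ℓ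
    → ((x : H) → ScottClosed (↓ x) × Irreducible (↓ x))
      × ((s : List ℕ) → ScottClosed (↓L s) × Irreducible (↓L s))
proposition5p6 em = (λ x → ↓-isScottClosed x , ↓-isIrreducible x)
                  , (λ s → ↓L-isScottClosed em s , ↓L-isIrreducible em s)
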